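{- Let $G=(V,E,w)$ be a finite simple undirected graph with positive vertex weights containing a $5$-cycle $v_1v_2v_3v_4v_5$ (edges $v_1v_2,v_2v_3,v_3v_4,v_4v_5,v_5v_1$) such that $d_G(v_2)=d_G(v_3)=d_G(v_5)=2$, $\min\{d_G(v_1),d_G(v_4)\}\ge 3$, and $w(v_1)\ge w(v_2)\ge w(v_3)\le w(v_4)$. (1) If $w(v_3)>w(v_5)$, let $G'$ be obtained from $G$ by deleting $v_5$ and changing the weight of $v_i$ to $w(v_i)-w(v_5)$ for $i=1,2,3,4$ (other weights unchanged). Then $\alpha(G)=\alpha(G')+2w(v_5)$. (2) If $w(v_3)\le w(v_5)$, let $G'$ be obtained from $G$ by deleting $v_2$ and $v_3$ and changing the weights to $w(v_1)-w(v_2)$ for $v_1$, $w(v_4)-w(v_3)$ for $v_4$ and $w(v_5)-w(v_3)$ for $v_5$ (other weights unchanged). Then $\alpha(G)=\alpha(G')+w(v_2)+w(v_3)$.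
   Context: $\alpha(H)$ denotes the maximum total vertex weight of an independent set in the weighted graph $H$; $d_G(v)$ is the degree of $v$ in $G$. All weights on the right-hand sides of the update rules refer to the weights in $G$.
   Formalization: The positive vertex weights of G take rational values, so the updated weights of G' and both values of α are rational as well. -}

module Defs where

open import Data.Nat using (ℕ; zero; suc)
open import Data.Bool using (Bool; true; false; _∧_; not; if_then_else_)
open import Data.Bool.Properties using (∧-comm)
open import Data.Fin using (Fin; _≟_)
open import Data.Fin.Properties using (all?)
open import Data.Fin.Subset using (Subset; _∈_)
open import Data.Fin.Subset.Properties using (_∈?_)
open import Data.Vec using (Vec; []; _∷_)
open import Data.List using (List; []; _∷_; map; foldr; filter; filterᵇ; length; allFin; _++_)
open import Data.Rational using (ℚ; 0ℚ; _+_; _-_; _⊔_)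
open import Relation.Nullary using (Dec; yes; no; does; ¬_)
open import Relation.Nullary.Decidable using (_→-dec_)
open import Relation.Binary.PropositionalEquality using (_≡_; refl; cong)
open import Data.Product using (_×_; _,_)

-- A finite simple undirected graph whose vertex set V is a subset of Fin n
-- (so that deleting vertices keeps the same ambient index type).
record Graph (n : ℕ) : Set where
  field
    V      : Fin n → Bool
    adj    : Fin n → Fin n → Bool
    sym    : ∀ u v → adj u v ≡ adj v u
    irrefl : ∀ v → adj v v ≡ false
    adjV   : ∀ u v → adj u v ≡ true → V u ≡ true
open Graph public

delete : ∀ {n} → Graph n → Fin n → Graph n
delete {n} G x = record
  { V      = λ v → V G v ∧ not (does (v ≟ x))
  ; adj    = λ u v → adj G u v ∧ not (does (u ≟ x)) ∧ not (does (v ≟ x))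
  ; sym    = λ u v → s u v
  ; irrefl = λ v → irr v
  ; adjV   = λ u v e → av u v e
  }
  where
  s : ∀ u v → adj G u v ∧ not (does (u ≟ x)) ∧ not (does (v ≟ x))
            ≡ adj G v u ∧ not (does (v ≟ x)) ∧ not (does (u ≟ x))
  s u v rewrite Graph.sym G u v with does (u ≟ x) | does (v ≟ x)
  ... | false | false = refl
  ... | false | true  = refl
  ... | true  | false = refl
  ... | true  | true  = refl
  irr : ∀ v → adj G v v ∧ not (does (v ≟ x)) ∧ not (does (v ≟ x)) ≡ false
  irr v rewrite irrefl G v = refl
  av : ∀ u v → adj G u v ∧ not (does (u ≟ x)) ∧ not (does (v ≟ x)) ≡ true
             → V G u ∧ not (does (u ≟ x)) ≡ true
  av u v e with adj G u v in eq | does (u ≟ x)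
  ... | true | false rewrite adjV G u v eq = refl
  av u v () | true | true
  av u v () | false | _

degree : ∀ {n} → Graph n → Fin n → ℕ
degree {n} G v = length (filterᵇ (adj G v) (allFin n))

Independent : ∀ {n} → Graph n → Subset n → Set
Independent {n} G S =
  (∀ v → v ∈ S → V G v ≡ true) × (∀ u v → u ∈ S → v ∈ S → adj G u v ≡ false)

independent? : ∀ {n} (G : Graph n) (S : Subset n) → Dec (Independent G S)
independent? G S with all? (λ v → (v ∈? S) →-dec (Data.Bool._≟_ (V G v) true))
                    | all? (λ u → all? (λ v → (u ∈? S) →-dec ((v ∈? S) →-dec Data.Bool._≟_ (adj G u v) false)))
... | yes p | yes q = yes (p , q)
... | no ¬p | _ = no λ { (p , _) → ¬p p }
... | yes _ | no ¬q = no λ { (_ , q) → ¬q q }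

allSubsets : ∀ n → List (Subset n)
allSubsets zero = [] ∷ []
allSubsets (suc n) = map (false ∷_) (allSubsets n) ++ map (true ∷_) (allSubsets n)

weight : ∀ {n} → (Fin n → ℚ) → Subset n → ℚ
weight {n} w S = foldr (λ v acc → w v + acc) 0ℚ (filter (_∈? S) (allFin n))

-- α(G,w): maximum total weight of an independent set of G
-- (the empty set is always independent, so the maximum starts from 0).
α : ∀ {n} → Graph n → (Fin n → ℚ) → ℚ
α {n} G w = foldr _⊔_ 0ℚ (map (weight w) (filter (independent? G) (allSubsets n)))

lower : ∀ {n} → (Fin n → ℚ) → Fin n → ℚ → Fin n → ℚ
lower w x c v = if does (v ≟ x) then w v - c else w v

-- Both sides are maxima over independent sets, so each inequality follows by turning
-- every independent set of one graph into one of the other whose weight, shifted by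
-- the constant, is at least as large.  The set is changed only on the degree-two
-- vertices v₂, v₃, v₅: their neighbours lie on the cycle, so any choice there that is
-- independent together with the unchanged choice on v₁ and v₄ keeps the whole set
-- independent, while the weights agree off the cycle.  What remains is a comparison
-- over the eleven independent sets of the 5-cycle.

{-# OPTIONS --safe #-}
module Submission where

open import Defs hiding (sym)
open import Data.Nat using (zero; suc; _≥_)
open import Data.Bool using (Bool; true; false; _∧_; _∨_; if_then_else_; T; T?)
open import Data.Bool.Properties using (∧-zeroʳ; ∧-identityʳ)
open import Data.Empty using (⊥; ⊥-elim)
open import Data.Unit using (tt)
open import Data.Fin using (Fin; zero; suc; _≟_)
open import Data.Fin.Subset using (Subset)
open import Data.Fin.Subset.Properties using () renaming (_∈?_ to _∈ˢ?_)
open import Data.List as List using (List; []; _∷_; filter; filterᵇ; length; allFin)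
open import Data.List.Membership.Propositional using () renaming (_∈_ to _∈ˡ_)
open import Data.List.Membership.Propositional.Properties
  using (∈-map⁺; ∈-map⁻; ∈-filter⁺; ∈-filter⁻; ∈-allFin; ∈-++⁺ˡ; ∈-++⁺ʳ)
open import Data.List.Relation.Unary.Any using () renaming (here to hereˡ; there to thereˡ)
open import Data.Vec as Vec using (Vec; []; _∷_; lookup; replicate; _[_]≔_)
open import Data.Vec.Properties using (lookup∘update; lookup∘update′; lookup-replicate; []=⇒lookup; lookup⇒[]=)
open import Data.Vec.Membership.Propositional using (_∈_; _∉_)
open import Data.Vec.Membership.Propositional.Properties using (∈-lookup)
open import Data.Vec.Relation.Unary.All as All using (All; []; _∷_)
open import Data.Vec.Relation.Unary.Any using (here; there; any?)
open import Data.Vec.Relation.Unary.Unique.Propositional using (Unique)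
open import Data.Vec.Relation.Unary.AllPairs using ([]; _∷_)
open import Data.Rational using (ℚ; 0ℚ; _+_; _-_; -_; _<_; _≤_; _⊔_)
open import Data.Rational.Properties
  using (≤-trans; ≤-reflexive; ≤-antisym; <⇒≤; +-identityˡ; +-identityʳ; +-assoc; +-comm;
         +-monoˡ-≤; +-monoʳ-≤; +-mono-≤; p≤p⊔q; p≤q⊔p; ⊔-lub;
         +-0-commutativeMonoid; module ≤-Reasoning)
open import Data.Rational.Solver using (module +-*-Solver)
open import Algebra.Properties.CommutativeMonoid.Sum +-0-commutativeMonoid
  using (sum; sum-cong-≗; sum-replicate-zero)
open import Data.Product using (_×_; _,_; proj₁; proj₂; Σ-syntax)
open import Data.Sum using (_⊎_; inj₁; inj₂)
open import Function using (_∘_)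
open import Relation.Nullary using (yes; no; does; contradiction)
open import Relation.Nullary.Decidable using (dec-true; dec-false)
open import Relation.Binary.PropositionalEquality
  using (_≡_; _≢_; refl; sym; trans; cong; cong₂; subst; subst₂; ≢-sym; module ≡-Reasoning)


≤-by : ∀ {x y} d → 0ℚ ≤ d → y ≡ x + d → x ≤ y
≤-by {x} d 0≤d refl = ≤-trans (≤-reflexive (sym (+-identityʳ x))) (+-monoʳ-≤ x 0≤d)

true-absurd : ∀ {b} {A : Set} → b ≡ false → b ≡ true → A
true-absurd refl ()

module _ where
  open +-*-Solver

  [x-y]+[y+z]≡x+z : ∀ x y z → (x - y) + (y + z) ≡ x + z
  [x-y]+[y+z]≡x+z = solve 3 (λ x y z → (x :- y) :+ (y :+ z) := x :+ z) refl

  [x-z]+[y+z]≡x+y : ∀ x y z → (x - z) + (y + z) ≡ x + y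
  [x-z]+[y+z]≡x+y = solve 3 (λ x y z → (x :- z) :+ (y :+ z) := x :+ y) refl

  [x-y]+[u-z]+[y+z]≡x+u : ∀ x u y z → ((x - y) + (u - z)) + (y + z) ≡ x + u
  [x-y]+[u-z]+[y+z]≡x+u = solve 4 (λ x u y z → ((x :- y) :+ (u :- z)) :+ (y :+ z) := x :+ u) refl

  [x+a]-a≡x : ∀ x a → (x + a) - a ≡ x
  [x+a]-a≡x = solve 2 (λ x a → (x :+ a) :- a := x) refl

  [x-a]+a≡x : ∀ x a → (x - a) + a ≡ x
  [x-a]+a≡x = solve 2 (λ x a → (x :- a) :+ a := x) refl

  x+[y+z]≡y+[x+z] : ∀ x y z → x + (y + z) ≡ y + (x + z)
  x+[y+z]≡y+[x+z] = solve 3 (λ x y z → x :+ (y :+ z) := y :+ (x :+ z)) refl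

  [x+r]+a≡[x+a]+r : ∀ x r a → (x + r) + a ≡ (x + a) + r
  [x+r]+a≡[x+a]+r = solve 3 (λ x r a → (x :+ r) :+ a := (x :+ a) :+ r) refl

erase : ∀ {m k} → Vec (Fin m) k → (Fin m → ℚ) → Fin m → ℚ
erase xs f v = if does (any? (v ≟_) xs) then 0ℚ else f v

sum-erase-point : ∀ {m} (x : Fin m) f → sum f ≡ f x + sum (erase (x ∷ []) f)
sum-erase-point zero    f = cong (f zero +_) (sym (+-identityˡ _))
sum-erase-point (suc x) f = begin
  f zero + sum (f ∘ suc)                                 ≡⟨ cong (f zero +_) (sum-erase-point x (f ∘ suc)) ⟩
  f zero + (f (suc x) + sum (erase (x ∷ []) (f ∘ suc)))  ≡⟨ x+[y+z]≡y+[x+z] (f zero) (f (suc x)) _ ⟩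
  f (suc x) + (f zero + sum (erase (x ∷ []) (f ∘ suc)))  ∎
  where open ≡-Reasoning

sum-erase : ∀ {m k} {xs : Vec (Fin m) k} → Unique xs → ∀ f →
            sum f ≡ sum (f ∘ lookup xs) + sum (erase xs f)
sum-erase [] f = sym (+-identityˡ (sum f))
sum-erase {xs = x ∷ ys} (x∉ys ∷ unique) f = begin
  sum f                                                ≡⟨ sum-erase-point x f ⟩
  f x + sum g                                          ≡⟨ cong (f x +_) (sum-erase unique g) ⟩
  f x + (sum (g ∘ lookup ys) + sum (erase ys g))
    ≡⟨ cong₂ (λ a b → f x + (a + b)) (sum-cong-≗ g≗f-on-ys) (sum-cong-≗ erase-erase) ⟩
  f x + (sum (f ∘ lookup ys) + sum (erase (x ∷ ys) f)) ≡⟨ sym (+-assoc (f x) _ _) ⟩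
  sum (f ∘ lookup (x ∷ ys)) + sum (erase (x ∷ ys) f)   ∎
  where
  open ≡-Reasoning
  g = erase (x ∷ []) f

  g≗f-on-ys : ∀ i → g (lookup ys i) ≡ f (lookup ys i)
  g≗f-on-ys i rewrite dec-false (lookup ys i ≟ x) (≢-sym (All.lookup x∉ys (∈-lookup i ys))) = refl

  if-∨ : ∀ a b (c : ℚ) → (if b then 0ℚ else (if a ∨ false then 0ℚ else c)) ≡ (if a ∨ b then 0ℚ else c)
  if-∨ true  true  c = refl
  if-∨ true  false c = refl
  if-∨ false true  c = refl
  if-∨ false false c = refl

  erase-erase : ∀ v → erase ys g v ≡ erase (x ∷ ys) f v
  erase-erase v = if-∨ (does (v ≟ x)) (does (any? (v ≟_) ys)) (f v)

erase-cong : ∀ {m k} (xs : Vec (Fin m) k) {f g : Fin m → ℚ} →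
             (∀ v → v ∉ xs → f v ≡ g v) → ∀ v → erase xs f v ≡ erase xs g v
erase-cong xs f≗g v with any? (v ≟_) xs
... | yes _    = refl
... | no v∉xs = f≗g v v∉xs

term : ∀ {n} → Subset n → (Fin n → ℚ) → Fin n → ℚ
term S w v = if lookup S v then w v else 0ℚ

does-∈ˢ?≡lookup : ∀ {n} (v : Fin n) (S : Subset n) → does (v ∈ˢ? S) ≡ lookup S v
does-∈ˢ?≡lookup zero    (true  ∷ S) = refl
does-∈ˢ?≡lookup zero    (false ∷ S) = refl
does-∈ˢ?≡lookup (suc v) (_ ∷ S)     = does-∈ˢ?≡lookup v S

weight≡sum : ∀ {n} (w : Fin n → ℚ) (S : Subset n) → weight w S ≡ sum (term S w)
weight≡sum {n} w S = go (λ v → v)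
  where
  go : ∀ {m} (g : Fin m → Fin n) →
       List.foldr (λ v acc → w v + acc) 0ℚ (filter (_∈ˢ? S) (List.tabulate g)) ≡ sum (term S w ∘ g)
  go {zero}  g = refl
  go {suc m} g with does (g zero ∈ˢ? S) | does-∈ˢ?≡lookup (g zero) S
  ... | true  | g₀∈S rewrite sym g₀∈S = cong (w (g zero) +_) (go (g ∘ suc))
  ... | false | g₀∉S rewrite sym g₀∉S = trans (go (g ∘ suc)) (sym (+-identityˡ _))

lower-≢ : ∀ {n} (w : Fin n → ℚ) {x c v} → v ≢ x → lower w x c v ≡ w v
lower-≢ w {x} {v = v} v≢x rewrite dec-false (v ≟ x) v≢x = refl

lower-self : ∀ {n} (w : Fin n → ℚ) x c → lower w x c x ≡ w x - c
lower-self w x c rewrite dec-true (x ≟ x) refl = refl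

-- α is the largest weight of an independent set

∈-allSubsets : ∀ {n} (S : Subset n) → S ∈ˡ allSubsets n
∈-allSubsets []          = hereˡ refl
∈-allSubsets (false ∷ S) = ∈-++⁺ˡ (∈-map⁺ (false ∷_) (∈-allSubsets S))
∈-allSubsets (true  ∷ S) = ∈-++⁺ʳ _ (∈-map⁺ (true ∷_) (∈-allSubsets S))

≤-foldr-⊔ : ∀ {x xs} → x ∈ˡ xs → x ≤ List.foldr _⊔_ 0ℚ xs
≤-foldr-⊔ {xs = y ∷ _} (hereˡ refl) = p≤p⊔q y _
≤-foldr-⊔ {xs = y ∷ _} (thereˡ x∈xs) = ≤-trans (≤-foldr-⊔ x∈xs) (p≤q⊔p y _)

foldr-⊔-≤ : ∀ {c} xs → 0ℚ ≤ c → (∀ {x} → x ∈ˡ xs → x ≤ c) → List.foldr _⊔_ 0ℚ xs ≤ c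
foldr-⊔-≤ []       0≤c xs≤c = 0≤c
foldr-⊔-≤ (x ∷ xs) 0≤c xs≤c = ⊔-lub (xs≤c (hereˡ refl)) (foldr-⊔-≤ xs 0≤c (xs≤c ∘ thereˡ))

weight≤α : ∀ {n} (G : Graph n) w {S} → Independent G S → weight w S ≤ α G w
weight≤α {n} G w {S} indep =
  ≤-foldr-⊔ (∈-map⁺ (weight w) (∈-filter⁺ (independent? G) (∈-allSubsets S) indep))

∅-independent : ∀ {n} (G : Graph n) → Independent G (replicate n false)
∅-independent {n} G = (λ v v∈∅ → ∉∅ v∈∅) , (λ u v u∈∅ _ → ∉∅ u∈∅)
  where
  ∉∅ : ∀ {v} {A : Set} → replicate n false Vec.[ v ]= true → A
  ∉∅ {v} v∈∅ with trans (sym (lookup-replicate v false)) ([]=⇒lookup v∈∅)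
  ... | ()

weight-∅ : ∀ {n} (w : Fin n → ℚ) → weight w (replicate n false) ≡ 0ℚ
weight-∅ {n} w = begin
  weight w (replicate n false) ≡⟨ weight≡sum w _ ⟩
  sum (term (replicate n false) w)
    ≡⟨ sum-cong-≗ (λ v → cong (λ b → if b then w v else 0ℚ) (lookup-replicate v false)) ⟩
  sum {n} (λ _ → 0ℚ) ≡⟨ sum-replicate-zero n ⟩
  0ℚ ∎
  where open ≡-Reasoning

α-least : ∀ {n} (G : Graph n) w {c} → (∀ S → Independent G S → weight w S ≤ c) → α G w ≤ c
α-least {n} G w {c} bound = foldr-⊔-≤ _ 0≤c weights≤c
  where
  0≤c : 0ℚ ≤ c
  0≤c = subst (_≤ c) (weight-∅ w) (bound _ (∅-independent G))

  weights≤c : ∀ {x} → x ∈ˡ List.map (weight w) (filter (independent? G) (allSubsets n)) → x ≤ c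
  weights≤c x∈ with ∈-map⁻ (weight w) x∈
  ... | S , S∈ , refl = bound S (proj₂ (∈-filter⁻ (independent? G) {xs = allSubsets n} S∈))

α-transfer : ∀ {n} {H K : Graph n} {wH wK : Fin n → ℚ} {a b : ℚ} →
             (∀ S → Independent H S → Σ[ T ∈ Subset n ] Independent K T × weight wH S + a ≤ weight wK T + b) →
             α H wH + a ≤ α K wK + b
α-transfer {H = H} {K} {wH} {wK} {a} {b} transfer =
  subst (α H wH + a ≤_) ([x-a]+a≡x _ a) (+-monoˡ-≤ a (α-least H wH S≤))
  where
  S≤ : ∀ S → Independent H S → weight wH S ≤ (α K wK + b) - a
  S≤ S indep with transfer S indep
  ... | T , indepT , S+a≤T+b =
    subst (_≤ (α K wK + b) - a) ([x+a]-a≡x _ a)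
          (+-monoˡ-≤ (- a) (≤-trans S+a≤T+b (+-monoˡ-≤ b (weight≤α K wK indepT))))

Stable : ∀ {n} → Graph n → Subset n → Set
Stable G S = ∀ u v → lookup S u ≡ true → lookup S v ≡ true → adj G u v ≡ false

Within : ∀ {n} → Subset n → Graph n → Set
Within S H = ∀ v → lookup S v ≡ true → V H v ≡ true

record Induced {n} (H G : Graph n) : Set where
  constructor induced
  field adj-agrees : ∀ u v → V H u ≡ true → V H v ≡ true → adj H u v ≡ adj G u v
open Induced

independent⇒within : ∀ {n} {H : Graph n} {S} → Independent H S → Within S H
independent⇒within {S = S} (S⊆V , _) v v∈S = S⊆V v (lookup⇒[]= v S v∈S)

independent⇒stable : ∀ {n} {H G : Graph n} {S} → Induced H G → Independent H S → Stable G S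
independent⇒stable {H = H} {S = S} H⊆G indep@(_ , nonadjacent) u v u∈S v∈S =
  trans (sym (adj-agrees H⊆G u v (S⊆H u u∈S) (S⊆H v v∈S))) (nonadjacent u v (lookup⇒[]= u S u∈S) (lookup⇒[]= v S v∈S))
  where S⊆H = independent⇒within {H = H} indep

stable⇒independent : ∀ {n} {K G : Graph n} {S} → Induced K G → Within S K → Stable G S → Independent K S
stable⇒independent K⊆G S⊆K stable =
  (λ v v∈S → S⊆K v ([]=⇒lookup v∈S)) ,
  (λ u v u∈S v∈S → trans (adj-agrees K⊆G u v (S⊆K u ([]=⇒lookup u∈S)) (S⊆K v ([]=⇒lookup v∈S)))
                         (stable u v ([]=⇒lookup u∈S) ([]=⇒lookup v∈S)))

stable-edge : ∀ {n} {G : Graph n} {S u v} → Stable G S → adj G u v ≡ true → lookup S u ∧ lookup S v ≡ false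
stable-edge {S = S} {u} {v} stable uv with lookup S u in u∈S | lookup S v in v∈S
... | false | _     = refl
... | true  | false = refl
... | true  | true  with () ← trans (sym uv) (stable u v u∈S v∈S)

V-delete-self : ∀ {n} (G : Graph n) x → V (delete G x) x ≡ false
V-delete-self G x rewrite dec-true (x ≟ x) refl = ∧-zeroʳ (V G x)

V-delete-≢ : ∀ {n} (G : Graph n) {x v} → v ≢ x → V (delete G x) v ≡ V G v
V-delete-≢ G {x} {v} v≢x rewrite dec-false (v ≟ x) v≢x = ∧-identityʳ (V G v)

V-delete⁻ : ∀ {n} (G : Graph n) {x v} → V (delete G x) v ≡ true → V G v ≡ true × v ≢ x
V-delete⁻ G {x} {v} v∈ with V G v | v ≟ x
... | true  | no v≢x = refl , v≢x
... | true  | yes _  with () ← v∈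
... | false | _      with () ← v∈

adj-delete-≢ : ∀ {n} (G : Graph n) {x u v} → u ≢ x → v ≢ x → adj (delete G x) u v ≡ adj G u v
adj-delete-≢ G {x} {u} {v} u≢x v≢x rewrite dec-false (u ≟ x) u≢x | dec-false (v ≟ x) v≢x = ∧-identityʳ (adj G u v)

induced-refl : ∀ {n} (G : Graph n) → Induced G G
induced-refl G = induced λ _ _ _ _ → refl

induced-delete : ∀ {n} {H G : Graph n} → Induced H G → ∀ x → Induced (delete H x) G
induced-delete {H = H} {G} H⊆G x = induced agrees
  where
  agrees : ∀ u v → V (delete H x) u ≡ true → V (delete H x) v ≡ true → adj (delete H x) u v ≡ adj G u v
  agrees u v u∈ v∈ with V-delete⁻ H u∈ | V-delete⁻ H v∈
  ... | u∈H , u≢x | v∈H , v≢x = trans (adj-delete-≢ H u≢x v≢x) (adj-agrees H⊆G u v u∈H v∈H)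

∈-length-two : ∀ {A : Set} {a b c : A} (L : List A) → length L ≡ 2 →
               a ∈ˡ L → b ∈ˡ L → a ≢ b → c ∈ˡ L → c ≡ a ⊎ c ≡ b
∈-length-two (_ ∷ _ ∷ []) _ (hereˡ refl)          (hereˡ refl)          a≢b _ = contradiction refl a≢b
∈-length-two (_ ∷ _ ∷ []) _ (thereˡ (hereˡ refl)) (thereˡ (hereˡ refl)) a≢b _ = contradiction refl a≢b
∈-length-two (_ ∷ _ ∷ []) _ (hereˡ refl)          (thereˡ (hereˡ refl)) _ (hereˡ refl)          = inj₁ refl
∈-length-two (_ ∷ _ ∷ []) _ (hereˡ refl)          (thereˡ (hereˡ refl)) _ (thereˡ (hereˡ refl)) = inj₂ refl
∈-length-two (_ ∷ _ ∷ []) _ (thereˡ (hereˡ refl)) (hereˡ refl)          _ (hereˡ refl)          = inj₂ refl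
∈-length-two (_ ∷ _ ∷ []) _ (thereˡ (hereˡ refl)) (hereˡ refl)          _ (thereˡ (hereˡ refl)) = inj₁ refl

degree-two-neighbours : ∀ {n} (G : Graph n) {x a b} → degree G x ≡ 2 →
                        adj G x a ≡ true → adj G x b ≡ true → a ≢ b →
                        ∀ c → adj G x c ≡ true → c ≡ a ⊎ c ≡ b
degree-two-neighbours {n} G {x} deg xa xb a≢b c xc =
  ∈-length-two _ deg (neighbour xa) (neighbour xb) a≢b (neighbour xc)
  where
  neighbour : ∀ {y} → adj G x y ≡ true → y ∈ˡ filterᵇ (adj G x) (allFin n)
  neighbour {y} xy = ∈-filter⁺ (T? ∘ adj G x) (∈-allFin y) (subst T (sym xy) tt)

-- Independent sets of the 5-cycle v₁v₂v₃v₄v₅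

pattern ⟨_,_,_,_,_⟩ a₁ a₂ a₃ a₄ a₅ = a₁ Vec.∷ a₂ Vec.∷ a₃ Vec.∷ a₄ Vec.∷ a₅ Vec.∷ Vec.[]

⟨,,,,⟩-cong : ∀ {A : Set} {a₁ a₂ a₃ a₄ a₅ b₁ b₂ b₃ b₄ b₅ : A} →
              a₁ ≡ b₁ → a₂ ≡ b₂ → a₃ ≡ b₃ → a₄ ≡ b₄ → a₅ ≡ b₅ →
              ⟨ a₁ , a₂ , a₃ , a₄ , a₅ ⟩ ≡ ⟨ b₁ , b₂ , b₃ , b₄ , b₅ ⟩
⟨,,,,⟩-cong refl refl refl refl refl = refl

data C₅ : Vec Bool 5 → Set where
  s∅  : C₅ ⟨ false , false , false , false , false ⟩
  s₁  : C₅ ⟨ true  , false , false , false , false ⟩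
  s₂  : C₅ ⟨ false , true  , false , false , false ⟩
  s₃  : C₅ ⟨ false , false , true  , false , false ⟩
  s₄  : C₅ ⟨ false , false , false , true  , false ⟩
  s₅  : C₅ ⟨ false , false , false , false , true  ⟩
  s₁₃ : C₅ ⟨ true  , false , true  , false , false ⟩
  s₁₄ : C₅ ⟨ true  , false , false , true  , false ⟩
  s₂₄ : C₅ ⟨ false , true  , false , true  , false ⟩
  s₂₅ : C₅ ⟨ false , true  , false , false , true  ⟩
  s₃₅ : C₅ ⟨ false , false , true  , false , true  ⟩

classify : ∀ b₁ b₂ b₃ b₄ b₅ → b₁ ∧ b₂ ≡ false → b₂ ∧ b₃ ≡ false → b₃ ∧ b₄ ≡ false →
           b₄ ∧ b₅ ≡ false → b₅ ∧ b₁ ≡ false → C₅ ⟨ b₁ , b₂ , b₃ , b₄ , b₅ ⟩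
classify true  true  _     _     _     () _  _  _  _
classify true  false _     _     true  _  _  _  _  ()
classify true  false true  true  false _  _  () _  _
classify true  false true  false false _  _  _  _  _ = s₁₃
classify true  false false true  false _  _  _  _  _ = s₁₄
classify true  false false false false _  _  _  _  _ = s₁
classify false true  true  _     _     _  () _  _  _
classify false true  false true  true  _  _  _  () _
classify false true  false true  false _  _  _  _  _ = s₂₄
classify false true  false false true  _  _  _  _  _ = s₂₅
classify false true  false false false _  _  _  _  _ = s₂
classify false false true  true  _     _  _  () _  _
classify false false true  false true  _  _  _  _  _ = s₃₅
classify false false true  false false _  _  _  _  _ = s₃
classify false false false true  true  _  _  _  () _
classify false false false true  false _  _  _  _  _ = s₄
classify false false false false true  _  _  _  _  _ = s₅
classify false false false false false _  _  _  _  _ = s∅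

no-edge₁₂ : ∀ {b₁ b₂ b₃ b₄ b₅} → C₅ ⟨ b₁ , b₂ , b₃ , b₄ , b₅ ⟩ → b₁ ≡ true → b₂ ≡ true → ⊥
no-edge₁₂ () refl refl

no-edge₂₃ : ∀ {b₁ b₂ b₃ b₄ b₅} → C₅ ⟨ b₁ , b₂ , b₃ , b₄ , b₅ ⟩ → b₂ ≡ true → b₃ ≡ true → ⊥
no-edge₂₃ () refl refl

no-edge₃₄ : ∀ {b₁ b₂ b₃ b₄ b₅} → C₅ ⟨ b₁ , b₂ , b₃ , b₄ , b₅ ⟩ → b₃ ≡ true → b₄ ≡ true → ⊥
no-edge₃₄ () refl refl

no-edge₄₅ : ∀ {b₁ b₂ b₃ b₄ b₅} → C₅ ⟨ b₁ , b₂ , b₃ , b₄ , b₅ ⟩ → b₄ ≡ true → b₅ ≡ true → ⊥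
no-edge₄₅ () refl refl

no-edge₅₁ : ∀ {b₁ b₂ b₃ b₄ b₅} → C₅ ⟨ b₁ , b₂ , b₃ , b₄ , b₅ ⟩ → b₅ ≡ true → b₁ ≡ true → ⊥
no-edge₅₁ () refl refl

-- v₁ and v₄ may have neighbours off the cycle, so a replacement only
-- changes the choice of the degree-two vertices v₂, v₃, v₅.
record Replacement (b₁ b₄ : Bool) : Set where
  constructor replace
  field
    {has₂ has₃ has₅} : Bool
    independent      : C₅ ⟨ b₁ , has₂ , has₃ , b₄ , has₅ ⟩
open Replacement

members : ∀ {b₁ b₄} → Replacement b₁ b₄ → Vec Bool 5
members {b₁} {b₄} r = ⟨ b₁ , has₂ r , has₃ r , b₄ , has₅ r ⟩

-- Summing only the selected weights, without a trailing 0ℚ, makes the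
-- weight of a concrete pattern compute to the sum one writes by hand.
total : List ℚ → ℚ
total []           = 0ℚ
total (x ∷ [])     = x
total (x ∷ y ∷ xs) = x + total (y ∷ xs)

selected : ∀ {k} → Vec Bool k → Vec ℚ k → List ℚ
selected []           []       = []
selected (true  ∷ bs) (W ∷ Ws) = W ∷ selected bs Ws
selected (false ∷ bs) (_ ∷ Ws) = selected bs Ws

infix 7 _·_
_·_ : ∀ {k} → Vec Bool k → Vec ℚ k → ℚ
bs · Ws = total (selected bs Ws)

·-∷ : ∀ {k} b W (bs : Vec Bool k) Ws → (if b then W else 0ℚ) + bs · Ws ≡ (b ∷ bs) · (W ∷ Ws)
·-∷ true  W bs Ws with selected bs Ws
... | []    = +-identityʳ W
... | _ ∷ _ = refl
·-∷ false W bs Ws = +-identityˡ _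

sum-term : ∀ {n k} (S : Subset n) w (xs : Vec (Fin n) k) →
           sum (term S w ∘ lookup xs) ≡ Vec.map (lookup S) xs · Vec.map w xs
sum-term S w []       = refl
sum-term S w (x ∷ xs) = trans (cong (term S w x +_) (sum-term S w xs)) (·-∷ (lookup S x) (w x) _ _)

-- The four exchanges on the 5-cycle

module _ (W₁ W₂ W₃ W₄ W₅ : ℚ) where

  drop-v₅ : 0ℚ ≤ W₂ → 0ℚ ≤ W₅ → ∀ {b₁ b₂ b₃ b₄ b₅} → C₅ ⟨ b₁ , b₂ , b₃ , b₄ , b₅ ⟩ →
            Σ[ r ∈ Replacement b₁ b₄ ] has₅ r ≡ false ×
              ⟨ b₁ , b₂ , b₃ , b₄ , b₅ ⟩ · ⟨ W₁ , W₂ , W₃ , W₄ , W₅ ⟩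
                ≤ members r · ⟨ W₁ - W₅ , W₂ - W₅ , W₃ - W₅ , W₄ - W₅ , W₅ ⟩ + (W₅ + W₅)
  drop-v₅ 0≤W₂ 0≤W₅ s∅  = replace s∅  , refl , ≤-by (W₅ + W₅) (+-mono-≤ 0≤W₅ 0≤W₅) refl
  drop-v₅ 0≤W₂ 0≤W₅ s₁  = replace s₁  , refl , ≤-by W₅ 0≤W₅ ([x-z]+[y+z]≡x+y W₁ W₅ W₅)
  drop-v₅ 0≤W₂ 0≤W₅ s₂  = replace s₂  , refl , ≤-by W₅ 0≤W₅ ([x-z]+[y+z]≡x+y W₂ W₅ W₅)
  drop-v₅ 0≤W₂ 0≤W₅ s₃  = replace s₃  , refl , ≤-by W₅ 0≤W₅ ([x-z]+[y+z]≡x+y W₃ W₅ W₅)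
  drop-v₅ 0≤W₂ 0≤W₅ s₄  = replace s₄  , refl , ≤-by W₅ 0≤W₅ ([x-z]+[y+z]≡x+y W₄ W₅ W₅)
  drop-v₅ 0≤W₂ 0≤W₅ s₅  = replace s₂  , refl , ≤-by W₂ 0≤W₂ (trans ([x-z]+[y+z]≡x+y W₂ W₅ W₅) (+-comm W₂ W₅))
  drop-v₅ 0≤W₂ 0≤W₅ s₁₃ = replace s₁₃ , refl , ≤-reflexive (sym ([x-y]+[u-z]+[y+z]≡x+u W₁ W₃ W₅ W₅))
  drop-v₅ 0≤W₂ 0≤W₅ s₁₄ = replace s₁₄ , refl , ≤-reflexive (sym ([x-y]+[u-z]+[y+z]≡x+u W₁ W₄ W₅ W₅))
  drop-v₅ 0≤W₂ 0≤W₅ s₂₄ = replace s₂₄ , refl , ≤-reflexive (sym ([x-y]+[u-z]+[y+z]≡x+u W₂ W₄ W₅ W₅))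
  drop-v₅ 0≤W₂ 0≤W₅ s₂₅ = replace s₂  , refl , ≤-reflexive (sym ([x-z]+[y+z]≡x+y W₂ W₅ W₅))
  drop-v₅ 0≤W₂ 0≤W₅ s₃₅ = replace s₃  , refl , ≤-reflexive (sym ([x-z]+[y+z]≡x+y W₃ W₅ W₅))

  restore-v₅ : W₅ ≤ W₃ → W₃ ≤ W₂ → ∀ {b₁ b₂ b₃ b₄} → C₅ ⟨ b₁ , b₂ , b₃ , b₄ , false ⟩ →
               Σ[ r ∈ Replacement b₁ b₄ ]
                 ⟨ b₁ , b₂ , b₃ , b₄ , false ⟩ · ⟨ W₁ - W₅ , W₂ - W₅ , W₃ - W₅ , W₄ - W₅ , W₅ ⟩ + (W₅ + W₅)
                   ≤ members r · ⟨ W₁ , W₂ , W₃ , W₄ , W₅ ⟩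
  restore-v₅ W₅≤W₃ W₃≤W₂ s∅  = replace s₂₅ , ≤-trans (≤-reflexive (+-identityˡ _)) (+-monoˡ-≤ W₅ W₅≤W₂)
    where W₅≤W₂ = ≤-trans W₅≤W₃ W₃≤W₂
  restore-v₅ W₅≤W₃ W₃≤W₂ s₁  = replace s₁₃ , ≤-trans (≤-reflexive ([x-z]+[y+z]≡x+y W₁ W₅ W₅)) (+-monoʳ-≤ W₁ W₅≤W₃)
  restore-v₅ W₅≤W₃ W₃≤W₂ s₂  = replace s₂₅ , ≤-reflexive ([x-z]+[y+z]≡x+y W₂ W₅ W₅)
  restore-v₅ W₅≤W₃ W₃≤W₂ s₃  = replace s₃₅ , ≤-reflexive ([x-z]+[y+z]≡x+y W₃ W₅ W₅)
  restore-v₅ W₅≤W₃ W₃≤W₂ s₄  = replace s₂₄ ,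
    ≤-trans (≤-reflexive (trans ([x-z]+[y+z]≡x+y W₄ W₅ W₅) (+-comm W₄ W₅))) (+-monoˡ-≤ W₄ (≤-trans W₅≤W₃ W₃≤W₂))
  restore-v₅ W₅≤W₃ W₃≤W₂ s₁₃ = replace s₁₃ , ≤-reflexive ([x-y]+[u-z]+[y+z]≡x+u W₁ W₃ W₅ W₅)
  restore-v₅ W₅≤W₃ W₃≤W₂ s₁₄ = replace s₁₄ , ≤-reflexive ([x-y]+[u-z]+[y+z]≡x+u W₁ W₄ W₅ W₅)
  restore-v₅ W₅≤W₃ W₃≤W₂ s₂₄ = replace s₂₄ , ≤-reflexive ([x-y]+[u-z]+[y+z]≡x+u W₂ W₄ W₅ W₅)

  drop-v₂v₃ : 0ℚ ≤ W₂ → 0ℚ ≤ W₃ → W₃ ≤ W₂ → ∀ {b₁ b₂ b₃ b₄ b₅} → C₅ ⟨ b₁ , b₂ , b₃ , b₄ , b₅ ⟩ →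
              Σ[ r ∈ Replacement b₁ b₄ ] has₂ r ≡ false × has₃ r ≡ false ×
                ⟨ b₁ , b₂ , b₃ , b₄ , b₅ ⟩ · ⟨ W₁ , W₂ , W₃ , W₄ , W₅ ⟩
                  ≤ members r · ⟨ W₁ - W₂ , W₂ , W₃ , W₄ - W₃ , W₅ - W₃ ⟩ + (W₂ + W₃)
  drop-v₂v₃ 0≤W₂ 0≤W₃ W₃≤W₂ s∅  = replace s∅ , refl , refl , ≤-by (W₂ + W₃) (+-mono-≤ 0≤W₂ 0≤W₃) refl
  drop-v₂v₃ 0≤W₂ 0≤W₃ W₃≤W₂ s₁  = replace s₁ , refl , refl , ≤-by W₃ 0≤W₃ ([x-y]+[y+z]≡x+z W₁ W₂ W₃)
  drop-v₂v₃ 0≤W₂ 0≤W₃ W₃≤W₂ s₂  = replace s∅ , refl , refl , ≤-by W₃ 0≤W₃ (+-identityˡ _)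
  drop-v₂v₃ 0≤W₂ 0≤W₃ W₃≤W₂ s₃  = replace s∅ , refl , refl , ≤-by W₂ 0≤W₂ (trans (+-identityˡ _) (+-comm W₂ W₃))
  drop-v₂v₃ 0≤W₂ 0≤W₃ W₃≤W₂ s₄  = replace s₄ , refl , refl , ≤-by W₂ 0≤W₂ ([x-z]+[y+z]≡x+y W₄ W₂ W₃)
  drop-v₂v₃ 0≤W₂ 0≤W₃ W₃≤W₂ s₅  = replace s₅ , refl , refl , ≤-by W₂ 0≤W₂ ([x-z]+[y+z]≡x+y W₅ W₂ W₃)
  drop-v₂v₃ 0≤W₂ 0≤W₃ W₃≤W₂ s₁₃ = replace s₁ , refl , refl , ≤-reflexive (sym ([x-y]+[y+z]≡x+z W₁ W₂ W₃))
  drop-v₂v₃ 0≤W₂ 0≤W₃ W₃≤W₂ s₁₄ = replace s₁₄ , refl , refl , ≤-reflexive (sym ([x-y]+[u-z]+[y+z]≡x+u W₁ W₄ W₂ W₃))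
  drop-v₂v₃ 0≤W₂ 0≤W₃ W₃≤W₂ s₂₄ = replace s₄ , refl , refl ,
    ≤-reflexive (sym (trans ([x-z]+[y+z]≡x+y W₄ W₂ W₃) (+-comm W₄ W₂)))
  drop-v₂v₃ 0≤W₂ 0≤W₃ W₃≤W₂ s₂₅ = replace s₅ , refl , refl ,
    ≤-reflexive (sym (trans ([x-z]+[y+z]≡x+y W₅ W₂ W₃) (+-comm W₅ W₂)))
  drop-v₂v₃ 0≤W₂ 0≤W₃ W₃≤W₂ s₃₅ = replace s₅ , refl , refl ,
    ≤-trans (≤-reflexive (+-comm W₃ W₅))
            (≤-trans (+-monoʳ-≤ W₅ W₃≤W₂) (≤-reflexive (sym ([x-z]+[y+z]≡x+y W₅ W₂ W₃))))

  restore-v₂v₃ : W₃ ≤ W₅ → ∀ {b₁ b₄ b₅} → C₅ ⟨ b₁ , false , false , b₄ , b₅ ⟩ →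
                 Σ[ r ∈ Replacement b₁ b₄ ]
                   ⟨ b₁ , false , false , b₄ , b₅ ⟩ · ⟨ W₁ - W₂ , W₂ , W₃ , W₄ - W₃ , W₅ - W₃ ⟩ + (W₂ + W₃)
                     ≤ members r · ⟨ W₁ , W₂ , W₃ , W₄ , W₅ ⟩
  restore-v₂v₃ W₃≤W₅ s∅  = replace s₂₅ , ≤-trans (≤-reflexive (+-identityˡ _)) (+-monoʳ-≤ W₂ W₃≤W₅)
  restore-v₂v₃ W₃≤W₅ s₁  = replace s₁₃ , ≤-reflexive ([x-y]+[y+z]≡x+z W₁ W₂ W₃)
  restore-v₂v₃ W₃≤W₅ s₄  = replace s₂₄ , ≤-reflexive (trans ([x-z]+[y+z]≡x+y W₄ W₂ W₃) (+-comm W₄ W₂))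
  restore-v₂v₃ W₃≤W₅ s₅  = replace s₂₅ , ≤-reflexive (trans ([x-z]+[y+z]≡x+y W₅ W₂ W₃) (+-comm W₅ W₂))
  restore-v₂v₃ W₃≤W₅ s₁₄ = replace s₁₄ , ≤-reflexive ([x-y]+[u-z]+[y+z]≡x+u W₁ W₄ W₂ W₃)

-- Moving independent sets across the reduction

module Pentagon {n} (G : Graph n) (x₁ x₂ x₃ x₄ x₅ : Fin n)
  (x₁≢x₂ : x₁ ≢ x₂) (x₁≢x₃ : x₁ ≢ x₃) (x₁≢x₄ : x₁ ≢ x₄) (x₁≢x₅ : x₁ ≢ x₅) (x₂≢x₃ : x₂ ≢ x₃)
  (x₂≢x₄ : x₂ ≢ x₄) (x₂≢x₅ : x₂ ≢ x₅) (x₃≢x₄ : x₃ ≢ x₄) (x₃≢x₅ : x₃ ≢ x₅) (x₄≢x₅ : x₄ ≢ x₅)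
  (x₁x₂ : adj G x₁ x₂ ≡ true) (x₂x₃ : adj G x₂ x₃ ≡ true) (x₃x₄ : adj G x₃ x₄ ≡ true)
  (x₄x₅ : adj G x₄ x₅ ≡ true) (x₅x₁ : adj G x₅ x₁ ≡ true)
  (N₂ : ∀ v → adj G x₂ v ≡ true → v ≡ x₁ ⊎ v ≡ x₃)
  (N₃ : ∀ v → adj G x₃ v ≡ true → v ≡ x₂ ⊎ v ≡ x₄)
  (N₅ : ∀ v → adj G x₅ v ≡ true → v ≡ x₄ ⊎ v ≡ x₁)
  where

  cycle : Vec (Fin n) 5
  cycle = ⟨ x₁ , x₂ , x₃ , x₄ , x₅ ⟩

  degreeTwo : Vec (Fin n) 3
  degreeTwo = x₂ ∷ x₃ ∷ x₅ ∷ []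

  cycle-unique : Unique cycle
  cycle-unique = (x₁≢x₂ ∷ x₁≢x₃ ∷ x₁≢x₄ ∷ x₁≢x₅ ∷ []) ∷ (x₂≢x₃ ∷ x₂≢x₄ ∷ x₂≢x₅ ∷ [])
               ∷ (x₃≢x₄ ∷ x₃≢x₅ ∷ []) ∷ (x₄≢x₅ ∷ []) ∷ [] ∷ []

  ∉cycle⇒∉degreeTwo : ∀ {v} → v ∉ cycle → v ∉ degreeTwo
  ∉cycle⇒∉degreeTwo v∉ (here v≡x₂)                 = v∉ (there (here v≡x₂))
  ∉cycle⇒∉degreeTwo v∉ (there (here v≡x₃))         = v∉ (there (there (here v≡x₃)))
  ∉cycle⇒∉degreeTwo v∉ (there (there (here v≡x₅))) = v∉ (there (there (there (there (here v≡x₅)))))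

  x₁∉degreeTwo : x₁ ∉ degreeTwo
  x₁∉degreeTwo (here x₁≡x₂)                 = x₁≢x₂ x₁≡x₂
  x₁∉degreeTwo (there (here x₁≡x₃))         = x₁≢x₃ x₁≡x₃
  x₁∉degreeTwo (there (there (here x₁≡x₅))) = x₁≢x₅ x₁≡x₅

  x₄∉degreeTwo : x₄ ∉ degreeTwo
  x₄∉degreeTwo (here x₄≡x₂)                 = x₂≢x₄ (sym x₄≡x₂)
  x₄∉degreeTwo (there (here x₄≡x₃))         = x₃≢x₄ (sym x₄≡x₃)
  x₄∉degreeTwo (there (there (here x₄≡x₅))) = x₄≢x₅ x₄≡x₅

  trace : ∀ {U} → Stable G U → C₅ (Vec.map (lookup U) cycle)
  trace {U} stable = classify _ _ _ _ _ (edge x₁x₂) (edge x₂x₃) (edge x₃x₄) (edge x₄x₅) (edge x₅x₁)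
    where
    edge : ∀ {u v} → adj G u v ≡ true → lookup U u ∧ lookup U v ≡ false
    edge = stable-edge {G = G} {S = U} stable

  Fits : Graph n → Bool → Bool → Bool → Set
  Fits H b₂ b₃ b₅ = (b₂ ≡ true → V H x₂ ≡ true) × (b₃ ≡ true → V H x₃ ≡ true) × (b₅ ≡ true → V H x₅ ≡ true)

  off-cycle : (Fin n → ℚ) → Subset n → ℚ
  off-cycle w S = sum (erase cycle (term S w))

  weight-split : ∀ w S → weight w S ≡ Vec.map (lookup S) cycle · Vec.map w cycle + off-cycle w S
  weight-split w S = begin
    weight w S                                                   ≡⟨ weight≡sum w S ⟩
    sum (term S w)                                               ≡⟨ sum-erase cycle-unique (term S w) ⟩
    sum (term S w ∘ lookup cycle) + off-cycle w S                ≡⟨ cong (_+ off-cycle w S) (sum-term S w cycle) ⟩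
    Vec.map (lookup S) cycle · Vec.map w cycle + off-cycle w S   ∎
    where open ≡-Reasoning

  override : (U : Subset n) → Replacement (lookup U x₁) (lookup U x₄) → Subset n
  override U r = U [ x₂ ]≔ has₂ r [ x₃ ]≔ has₃ r [ x₅ ]≔ has₅ r

  module _ (U : Subset n) (r : Replacement (lookup U x₁) (lookup U x₄)) where

    private
      U₂  = U [ x₂ ]≔ has₂ r
      U₂₃ = U₂ [ x₃ ]≔ has₃ r

    override-outside : ∀ {v} → v ∉ degreeTwo → lookup (override U r) v ≡ lookup U v
    override-outside v∉ = trans (lookup∘update′ (v∉ ∘ there ∘ there ∘ here) U₂₃ _)
                         (trans (lookup∘update′ (v∉ ∘ there ∘ here) U₂ _) (lookup∘update′ (v∉ ∘ here) U _))

    override-x₂ : lookup (override U r) x₂ ≡ has₂ r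
    override-x₂ = trans (lookup∘update′ x₂≢x₅ U₂₃ _) (trans (lookup∘update′ x₂≢x₃ U₂ _) (lookup∘update x₂ U _))

    override-x₃ : lookup (override U r) x₃ ≡ has₃ r
    override-x₃ = trans (lookup∘update′ x₃≢x₅ U₂₃ _) (lookup∘update x₃ U₂ _)

    override-x₅ : lookup (override U r) x₅ ≡ has₅ r
    override-x₅ = lookup∘update x₅ U₂₃ _

    override-on-cycle : Vec.map (lookup (override U r)) cycle ≡ members r
    override-on-cycle = ⟨,,,,⟩-cong (override-outside x₁∉degreeTwo) override-x₂ override-x₃
                                    (override-outside x₄∉degreeTwo) override-x₅

    -- A degree-two vertex of the new set has only cycle neighbours, which the
    -- independent pattern excludes.
    override-isolated : ∀ {u v} → u ∈ degreeTwo → lookup (override U r) u ≡ true →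
                        lookup (override U r) v ≡ true → adj G u v ≡ false
    override-isolated {u} {v} u∈D u∈ v∈ with adj G u v in uv
    ... | false = refl
    ... | true  = ⊥-elim (clash u∈D uv)
      where
      s = independent r
      at₁ : lookup (override U r) x₁ ≡ true → lookup U x₁ ≡ true
      at₁ = trans (sym (override-outside x₁∉degreeTwo))
      at₄ : lookup (override U r) x₄ ≡ true → lookup U x₄ ≡ true
      at₄ = trans (sym (override-outside x₄∉degreeTwo))
      at₂ = trans (sym override-x₂)
      at₃ = trans (sym override-x₃)
      at₅ = trans (sym override-x₅)

      clash : u ∈ degreeTwo → adj G u v ≡ true → ⊥
      clash (here refl) uv with N₂ v uv
      ... | inj₁ refl = no-edge₁₂ s (at₁ v∈) (at₂ u∈)
      ... | inj₂ refl = no-edge₂₃ s (at₂ u∈) (at₃ v∈)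
      clash (there (here refl)) uv with N₃ v uv
      ... | inj₁ refl = no-edge₂₃ s (at₂ v∈) (at₃ u∈)
      ... | inj₂ refl = no-edge₃₄ s (at₃ u∈) (at₄ v∈)
      clash (there (there (here refl))) uv with N₅ v uv
      ... | inj₁ refl = no-edge₄₅ s (at₄ v∈) (at₅ u∈)
      ... | inj₂ refl = no-edge₅₁ s (at₅ u∈) (at₁ v∈)

    override-stable : Stable G U → Stable G (override U r)
    override-stable stable u v u∈ v∈ with any? (u ≟_) degreeTwo | any? (v ≟_) degreeTwo
    ... | yes u∈D | _       = override-isolated u∈D u∈ v∈
    ... | no _    | yes v∈D = trans (Graph.sym G u v) (override-isolated v∈D v∈ u∈)
    ... | no u∉D  | no v∉D  =
      stable u v (trans (sym (override-outside u∉D)) u∈) (trans (sym (override-outside v∉D)) v∈)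

    override-within : ∀ {H K} → (∀ v → v ∉ degreeTwo → V H v ≡ V K v) → Within U H →
                      Fits K (has₂ r) (has₃ r) (has₅ r) → Within (override U r) K
    override-within H≈K U⊆H (fits₂ , fits₃ , fits₅) v v∈ with any? (v ≟_) degreeTwo
    ... | yes (here refl)                 = fits₂ (trans (sym override-x₂) v∈)
    ... | yes (there (here refl))         = fits₃ (trans (sym override-x₃) v∈)
    ... | yes (there (there (here refl))) = fits₅ (trans (sym override-x₅) v∈)
    ... | no v∉D = trans (sym (H≈K v v∉D)) (U⊆H v (trans (sym (override-outside v∉D)) v∈))

    weight-override : ∀ {w w′} → (∀ v → v ∉ cycle → w′ v ≡ w v) →
                      weight w′ (override U r) ≡ members r · Vec.map w′ cycle + off-cycle w U
    weight-override {w′ = w′} w′≈w = trans (weight-split w′ (override U r))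
      (cong₂ (λ bs R → bs · Vec.map w′ cycle + R) override-on-cycle
             (sum-cong-≗ (erase-cong cycle λ v v∉ →
               cong₂ (λ b W → if b then W else 0ℚ) (override-outside (∉cycle⇒∉degreeTwo v∉)) (w′≈w v v∉))))

  Exchange : Graph n → Graph n → Vec ℚ 5 → ℚ → Vec ℚ 5 → ℚ → Set
  Exchange H K WH a WK b =
    ∀ {b₁ b₂ b₃ b₄ b₅} → C₅ ⟨ b₁ , b₂ , b₃ , b₄ , b₅ ⟩ → Fits H b₂ b₃ b₅ →
    Σ[ r ∈ Replacement b₁ b₄ ] Fits K (has₂ r) (has₃ r) (has₅ r) ×
      ⟨ b₁ , b₂ , b₃ , b₄ , b₅ ⟩ · WH + a ≤ members r · WK + b

  transfer : ∀ {H K : Graph n} {wH wK : Fin n → ℚ} {WH WK a b} →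
             Induced H G → Induced K G → (∀ v → v ∉ degreeTwo → V H v ≡ V K v) →
             (∀ v → v ∉ cycle → wK v ≡ wH v) → Vec.map wH cycle ≡ WH → Vec.map wK cycle ≡ WK →
             Exchange H K WH a WK b → α H wH + a ≤ α K wK + b
  transfer {H} {K} {wH} {wK} {a = a} {b} H⊆G K⊆G H≈K wK≈wH wH-on-cycle wK-on-cycle exchange =
    α-transfer {H = H} {K} {wH} {wK} {a} {b} step
    where
    step : ∀ U → Independent H U → Σ[ T ∈ Subset n ] Independent K T × weight wH U + a ≤ weight wK T + b
    step U indep =
      override U r ,
      stable⇒independent K⊆G (override-within U r {H} {K} H≈K U⊆H fits) (override-stable U r stable) ,
      (begin
        weight wH U + a ≡⟨ cong (_+ a) (weight-split wH U) ⟩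
        (P + R) + a     ≡⟨ [x+r]+a≡[x+a]+r P R a ⟩
        (P + a) + R     ≤⟨ +-monoˡ-≤ R P+a≤Q+b ⟩
        (Q + b) + R     ≡⟨ [x+r]+a≡[x+a]+r Q b R ⟩
        (Q + R) + b     ≡⟨ cong (_+ b) (weight-override U r {wH} {wK} wK≈wH) ⟨
        weight wK (override U r) + b ∎)
      where
      open ≤-Reasoning
      stable    = independent⇒stable {S = U} H⊆G indep
      U⊆H       = independent⇒within {H = H} {S = U} indep
      exchanged = exchange (trace {U} stable) (U⊆H x₂ , U⊆H x₃ , U⊆H x₅)
      r         = proj₁ exchanged
      fits      = proj₁ (proj₂ exchanged)
      P+a≤Q+b   = subst₂ (λ X Y → Vec.map (lookup U) cycle · X + a ≤ members r · Y + b)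
                         (sym wH-on-cycle) (sym wK-on-cycle) (proj₂ (proj₂ exchanged))
      P = Vec.map (lookup U) cycle · Vec.map wH cycle
      Q = members r · Vec.map wK cycle
      R = off-cycle wH U

  module _ (w : Fin n → ℚ) (x₂∈ : V G x₂ ≡ true) (x₃∈ : V G x₃ ≡ true) (x₅∈ : V G x₅ ≡ true) where

    fits-G : ∀ {b₂ b₃ b₅} → Fits G b₂ b₃ b₅
    fits-G = (λ _ → x₂∈) , (λ _ → x₃∈) , (λ _ → x₅∈)

    G-v₅ : Graph n
    G-v₅ = delete G x₅

    G≈G-v₅ : ∀ v → v ∉ degreeTwo → V G v ≡ V G-v₅ v
    G≈G-v₅ v v∉ = sym (V-delete-≢ G (v∉ ∘ there ∘ there ∘ here))

    private
      l₁ = lower w  x₁ (w x₅)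
      l₂ = lower l₁ x₂ (w x₅)
      l₃ = lower l₂ x₃ (w x₅)

    w-v₅ : Fin n → ℚ
    w-v₅ = lower l₃ x₄ (w x₅)

    w-v₅-untouched : ∀ {v} → v ≢ x₁ → v ≢ x₂ → v ≢ x₃ → v ≢ x₄ → w-v₅ v ≡ w v
    w-v₅-untouched v≢x₁ v≢x₂ v≢x₃ v≢x₄ =
      trans (lower-≢ l₃ v≢x₄) (trans (lower-≢ l₂ v≢x₃) (trans (lower-≢ l₁ v≢x₂) (lower-≢ w v≢x₁)))

    w-v₅-off-cycle : ∀ v → v ∉ cycle → w-v₅ v ≡ w v
    w-v₅-off-cycle v v∉ = w-v₅-untouched (v∉ ∘ here) (v∉ ∘ there ∘ here) (v∉ ∘ there ∘ there ∘ here)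
                                         (v∉ ∘ there ∘ there ∘ there ∘ here)

    w-v₅-on-cycle : Vec.map w-v₅ cycle ≡ ⟨ w x₁ - w x₅ , w x₂ - w x₅ , w x₃ - w x₅ , w x₄ - w x₅ , w x₅ ⟩
    w-v₅-on-cycle = ⟨,,,,⟩-cong
      (trans (lower-≢ l₃ x₁≢x₄) (trans (lower-≢ l₂ x₁≢x₃) (trans (lower-≢ l₁ x₁≢x₂) (lower-self w x₁ _))))
      (trans (lower-≢ l₃ x₂≢x₄) (trans (lower-≢ l₂ x₂≢x₃)
        (trans (lower-self l₁ x₂ _) (cong (_- w x₅) (lower-≢ w (≢-sym x₁≢x₂))))))
      (trans (lower-≢ l₃ x₃≢x₄) (trans (lower-self l₂ x₃ _)
        (cong (_- w x₅) (trans (lower-≢ l₁ (≢-sym x₂≢x₃)) (lower-≢ w (≢-sym x₁≢x₃))))))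
      (trans (lower-self l₃ x₄ _) (cong (_- w x₅)
        (trans (lower-≢ l₂ (≢-sym x₃≢x₄)) (trans (lower-≢ l₁ (≢-sym x₂≢x₄)) (lower-≢ w (≢-sym x₁≢x₄))))))
      (w-v₅-untouched (≢-sym x₁≢x₅) (≢-sym x₂≢x₅) (≢-sym x₃≢x₅) (≢-sym x₄≢x₅))

    exchange-drop-v₅ : 0ℚ ≤ w x₂ → 0ℚ ≤ w x₅ →
                       Exchange G G-v₅ (Vec.map w cycle) 0ℚ
                                ⟨ w x₁ - w x₅ , w x₂ - w x₅ , w x₃ - w x₅ , w x₄ - w x₅ , w x₅ ⟩ (w x₅ + w x₅)
    exchange-drop-v₅ 0≤w₂ 0≤w₅ s _ with drop-v₅ (w x₁) (w x₂) (w x₃) (w x₄) (w x₅) 0≤w₂ 0≤w₅ s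
    ... | r , ∉r , ineq =
      r , ((λ _ → trans (V-delete-≢ G x₂≢x₅) x₂∈) , (λ _ → trans (V-delete-≢ G x₃≢x₅) x₃∈) , true-absurd ∉r) ,
      ≤-trans (≤-reflexive (+-identityʳ _)) ineq

    exchange-restore-v₅ : w x₅ ≤ w x₃ → w x₃ ≤ w x₂ →
                          Exchange G-v₅ G ⟨ w x₁ - w x₅ , w x₂ - w x₅ , w x₃ - w x₅ , w x₄ - w x₅ , w x₅ ⟩
                                   (w x₅ + w x₅) (Vec.map w cycle) 0ℚ
    exchange-restore-v₅ _ _ {b₅ = true} _ (_ , _ , x₅∈G-v₅) = true-absurd (V-delete-self G x₅) (x₅∈G-v₅ refl)
    exchange-restore-v₅ w₅≤w₃ w₃≤w₂ {b₅ = false} s _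
      with restore-v₅ (w x₁) (w x₂) (w x₃) (w x₄) (w x₅) w₅≤w₃ w₃≤w₂ s
    ... | r , ineq =
      r , fits-G ,
      ≤-trans ineq (≤-reflexive (sym (+-identityʳ _)))

    α-without-v₅ : 0ℚ ≤ w x₂ → 0ℚ ≤ w x₅ → w x₅ ≤ w x₃ → w x₃ ≤ w x₂ →
                   α G w ≡ α G-v₅ w-v₅ + (w x₅ + w x₅)
    α-without-v₅ 0≤w₂ 0≤w₅ w₅≤w₃ w₃≤w₂ = trans (sym (+-identityʳ _)) (≤-antisym
      (transfer G⊆G G-v₅⊆G G≈G-v₅ w-v₅-off-cycle refl w-v₅-on-cycle (exchange-drop-v₅ 0≤w₂ 0≤w₅))
      (transfer G-v₅⊆G G⊆G (λ v v∉ → sym (G≈G-v₅ v v∉)) (λ v v∉ → sym (w-v₅-off-cycle v v∉)) w-v₅-on-cycle refl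
                (exchange-restore-v₅ w₅≤w₃ w₃≤w₂)))
      where
      G⊆G     = induced-refl G
      G-v₅⊆G = induced-delete G⊆G x₅

    G-v₂v₃ : Graph n
    G-v₂v₃ = delete (delete G x₂) x₃

    G≈G-v₂v₃ : ∀ v → v ∉ degreeTwo → V G v ≡ V G-v₂v₃ v
    G≈G-v₂v₃ v v∉ = sym (trans (V-delete-≢ (delete G x₂) (v∉ ∘ there ∘ here)) (V-delete-≢ G (v∉ ∘ here)))

    private
      m₁ = lower w  x₁ (w x₂)
      m₄ = lower m₁ x₄ (w x₃)

    w-v₂v₃ : Fin n → ℚ
    w-v₂v₃ = lower m₄ x₅ (w x₃)

    w-v₂v₃-untouched : ∀ {v} → v ≢ x₁ → v ≢ x₄ → v ≢ x₅ → w-v₂v₃ v ≡ w v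
    w-v₂v₃-untouched v≢x₁ v≢x₄ v≢x₅ = trans (lower-≢ m₄ v≢x₅) (trans (lower-≢ m₁ v≢x₄) (lower-≢ w v≢x₁))

    w-v₂v₃-off-cycle : ∀ v → v ∉ cycle → w-v₂v₃ v ≡ w v
    w-v₂v₃-off-cycle v v∉ = w-v₂v₃-untouched (v∉ ∘ here) (v∉ ∘ there ∘ there ∘ there ∘ here)
                                             (v∉ ∘ there ∘ there ∘ there ∘ there ∘ here)

    w-v₂v₃-on-cycle : Vec.map w-v₂v₃ cycle ≡ ⟨ w x₁ - w x₂ , w x₂ , w x₃ , w x₄ - w x₃ , w x₅ - w x₃ ⟩
    w-v₂v₃-on-cycle = ⟨,,,,⟩-cong
      (trans (lower-≢ m₄ x₁≢x₅) (trans (lower-≢ m₁ x₁≢x₄) (lower-self w x₁ _)))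
      (w-v₂v₃-untouched (≢-sym x₁≢x₂) x₂≢x₄ x₂≢x₅)
      (w-v₂v₃-untouched (≢-sym x₁≢x₃) x₃≢x₄ x₃≢x₅)
      (trans (lower-≢ m₄ x₄≢x₅) (trans (lower-self m₁ x₄ _) (cong (_- w x₃) (lower-≢ w (≢-sym x₁≢x₄)))))
      (trans (lower-self m₄ x₅ _) (cong (_- w x₃) (trans (lower-≢ m₁ (≢-sym x₄≢x₅)) (lower-≢ w (≢-sym x₁≢x₅)))))

    exchange-drop-v₂v₃ : 0ℚ ≤ w x₂ → 0ℚ ≤ w x₃ → w x₃ ≤ w x₂ →
                         Exchange G G-v₂v₃ (Vec.map w cycle) 0ℚ
                                  ⟨ w x₁ - w x₂ , w x₂ , w x₃ , w x₄ - w x₃ , w x₅ - w x₃ ⟩ (w x₂ + w x₃)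
    exchange-drop-v₂v₃ 0≤w₂ 0≤w₃ w₃≤w₂ s _ with drop-v₂v₃ (w x₁) (w x₂) (w x₃) (w x₄) (w x₅) 0≤w₂ 0≤w₃ w₃≤w₂ s
    ... | r , ∉r₂ , ∉r₃ , ineq =
      r , (true-absurd ∉r₂ , true-absurd ∉r₃ ,
           (λ _ → trans (V-delete-≢ (delete G x₂) (≢-sym x₃≢x₅)) (trans (V-delete-≢ G (≢-sym x₂≢x₅)) x₅∈))) ,
      ≤-trans (≤-reflexive (+-identityʳ _)) ineq

    exchange-restore-v₂v₃ : w x₃ ≤ w x₅ →
                            Exchange G-v₂v₃ G ⟨ w x₁ - w x₂ , w x₂ , w x₃ , w x₄ - w x₃ , w x₅ - w x₃ ⟩
                                     (w x₂ + w x₃) (Vec.map w cycle) 0ℚ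
    exchange-restore-v₂v₃ _ {b₂ = true} _ (x₂∈G-v₂v₃ , _ , _) =
      true-absurd (trans (V-delete-≢ (delete G x₂) x₂≢x₃) (V-delete-self G x₂)) (x₂∈G-v₂v₃ refl)
    exchange-restore-v₂v₃ _ {b₂ = false} {b₃ = true} _ (_ , x₃∈G-v₂v₃ , _) =
      true-absurd (V-delete-self (delete G x₂) x₃) (x₃∈G-v₂v₃ refl)
    exchange-restore-v₂v₃ w₃≤w₅ {b₂ = false} {b₃ = false} s _
      with restore-v₂v₃ (w x₁) (w x₂) (w x₃) (w x₄) (w x₅) w₃≤w₅ s
    ... | r , ineq =
      r , fits-G ,
      ≤-trans ineq (≤-reflexive (sym (+-identityʳ _)))

    α-without-v₂v₃ : 0ℚ ≤ w x₂ → 0ℚ ≤ w x₃ → w x₃ ≤ w x₂ → w x₃ ≤ w x₅ →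
                     α G w ≡ α G-v₂v₃ w-v₂v₃ + (w x₂ + w x₃)
    α-without-v₂v₃ 0≤w₂ 0≤w₃ w₃≤w₂ w₃≤w₅ = trans (sym (+-identityʳ _)) (≤-antisym
      (transfer G⊆G G-v₂v₃⊆G G≈G-v₂v₃ w-v₂v₃-off-cycle refl w-v₂v₃-on-cycle (exchange-drop-v₂v₃ 0≤w₂ 0≤w₃ w₃≤w₂))
      (transfer G-v₂v₃⊆G G⊆G (λ v v∉ → sym (G≈G-v₂v₃ v v∉)) (λ v v∉ → sym (w-v₂v₃-off-cycle v v∉))
                w-v₂v₃-on-cycle refl
                (exchange-restore-v₂v₃ w₃≤w₅)))
      where
      G⊆G       = induced-refl G
      G-v₂v₃⊆G = induced-delete (induced-delete G⊆G x₂) x₃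

-- The bounds w v₂ ≤ w v₁, w v₃ ≤ w v₄ and the degrees of v₁, v₄ only make the reduced
-- instance positively weighted again; the two identities do not need them.
lemma7 : ∀ {n} (G : Graph n) (w : Fin n → ℚ)
    → (∀ v → V G v ≡ true → 0ℚ < w v)
    → (v₁ v₂ v₃ v₄ v₅ : Fin n)
    → v₁ ≢ v₂ → v₁ ≢ v₃ → v₁ ≢ v₄ → v₁ ≢ v₅ → v₂ ≢ v₃
    → v₂ ≢ v₄ → v₂ ≢ v₅ → v₃ ≢ v₄ → v₃ ≢ v₅ → v₄ ≢ v₅
    → V G v₁ ≡ true → V G v₂ ≡ true → V G v₃ ≡ true → V G v₄ ≡ true → V G v₅ ≡ true
    → adj G v₁ v₂ ≡ true → adj G v₂ v₃ ≡ true → adj G v₃ v₄ ≡ true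
    → adj G v₄ v₅ ≡ true → adj G v₅ v₁ ≡ true
    → degree G v₂ ≡ 2 → degree G v₃ ≡ 2 → degree G v₅ ≡ 2
    → degree G v₁ ≥ 3 → degree G v₄ ≥ 3
    → w v₂ ≤ w v₁ → w v₃ ≤ w v₂ → w v₃ ≤ w v₄
    → (w v₅ < w v₃
         → α G w ≡ α (delete G v₅)
                     (lower (lower (lower (lower w v₁ (w v₅)) v₂ (w v₅)) v₃ (w v₅)) v₄ (w v₅))
                   + (w v₅ + w v₅))
    × (w v₃ ≤ w v₅
         → α G w ≡ α (delete (delete G v₂) v₃)
                     (lower (lower (lower w v₁ (w v₂)) v₄ (w v₃)) v₅ (w v₃))
                   + (w v₂ + w v₃))
lemma7 G w positive v₁ v₂ v₃ v₄ v₅ v₁≢v₂ v₁≢v₃ v₁≢v₄ v₁≢v₅ v₂≢v₃ v₂≢v₄ v₂≢v₅ v₃≢v₄ v₃≢v₅ v₄≢v₅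
       _ v₂∈ v₃∈ _ v₅∈ v₁v₂ v₂v₃ v₃v₄ v₄v₅ v₅v₁ deg₂ deg₃ deg₅ _ _ _ w₃≤w₂ _ =
  (λ w₅<w₃ → α-without-v₅ w v₂∈ v₃∈ v₅∈ (0≤w v₂∈) (0≤w v₅∈) (<⇒≤ w₅<w₃) w₃≤w₂) ,
  (λ w₃≤w₅ → α-without-v₂v₃ w v₂∈ v₃∈ v₅∈ (0≤w v₂∈) (0≤w v₃∈) w₃≤w₂ w₃≤w₅)
  where
  0≤w : ∀ {v} → V G v ≡ true → 0ℚ ≤ w v
  0≤w v∈ = <⇒≤ (positive _ v∈)

  open Pentagon G v₁ v₂ v₃ v₄ v₅ v₁≢v₂ v₁≢v₃ v₁≢v₄ v₁≢v₅ v₂≢v₃ v₂≢v₄ v₂≢v₅ v₃≢v₄ v₃≢v₅ v₄≢v₅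
                v₁v₂ v₂v₃ v₃v₄ v₄v₅ v₅v₁
                (degree-two-neighbours G deg₂ (trans (Graph.sym G v₂ v₁) v₁v₂) v₂v₃ v₁≢v₃)
                (degree-two-neighbours G deg₃ (trans (Graph.sym G v₃ v₂) v₂v₃) v₃v₄ v₂≢v₄)
                (degree-two-neighbours G deg₅ (trans (Graph.sym G v₅ v₄) v₄v₅) v₅v₁ (≢-sym v₁≢v₄))
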